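{- For every integer $p\ge1$, every $(pK_2\cup P_4)$-free graph $G$ satisfies $\chi(G)\le {\omega(G)+2p \choose 2p+1}$.
   Context: $P_4$ is the path on $4$ vertices, $pK_2$ the disjoint union of $p$ edges, and $pK_2\cup P_4$ their disjoint union; a graph is $(pK_2\cup P_4)$-free if it has no induced subgraph isomorphic to $pK_2\cup P_4$. $\chi$ is the chromatic number and $\omega$ the clique number. -}

module Defs where

open import Data.Nat using (ℕ; zero; suc; _+_; _*_; _≤_; _<_; _≡ᵇ_; _<ᵇ_; _≤ᵇ_)
open import Data.Fin using (Fin; toℕ)
open import Data.Product using (Σ; _×_; _,_; ∃)
open import Data.Sum using (_⊎_)
open import Data.Bool using (Bool; true; false; _∧_; _∨_; not; T; T?)
open import Data.Bool.Properties using (∨-comm)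
open import Data.Empty using (⊥)
open import Relation.Nullary using (¬_; Dec)
open import Relation.Binary.PropositionalEquality using (_≡_; refl)
open import Function.Definitions using (Injective)
open import Function.Bundles using (_⇔_)

record Graph : Set₁ where
  field
    n     : ℕ
    Adj   : Fin n → Fin n → Set
    adj?  : ∀ u v → Dec (Adj u v)
    sym   : ∀ {u v} → Adj u v → Adj v u
    irrefl : ∀ {u} → ¬ Adj u u
open Graph public

InducedSub : Graph → Graph → Set
InducedSub H G = Σ (Fin (n H) → Fin (n G)) λ f →
  Injective _≡_ _≡_ f × (∀ u v → Adj H u v ⇔ Adj G (f u) (f v))

Free : Graph → Graph → Set
Free H G = ¬ InducedSub H G

even : ℕ → Bool
even zero = true
even (suc k) = not (even k)

-- Edge test of pK₂ ∪ P₄ on vertices 0 .. 2p+3 (as naturals, a < b):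
-- the edges are {2k, 2k+1} for k < p (the p disjoint edges), and the
-- path 2p — 2p+1 — 2p+2 — 2p+3 (the P₄).
edge? : ℕ → ℕ → ℕ → Bool
edge? p a b = (suc a ≡ᵇ b) ∧ (((a <ᵇ (2 * p)) ∧ even a) ∨ ((2 * p) ≤ᵇ a))

PAdjᵇ : (p : ℕ) → Fin (2 * p + 4) → Fin (2 * p + 4) → Bool
PAdjᵇ p u v = edge? p (toℕ u) (toℕ v) ∨ edge? p (toℕ v) (toℕ u)


private
  suc≢ᵇ : ∀ a → (suc a ≡ᵇ a) ≡ false
  suc≢ᵇ zero = refl
  suc≢ᵇ (suc a) = suc≢ᵇ a

  PAdj-irrefl : ∀ p (u : Fin (2 * p + 4)) → ¬ T (PAdjᵇ p u u)
  PAdj-irrefl p u t rewrite suc≢ᵇ (toℕ u) = t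

  PAdj-sym : ∀ p (u v : Fin (2 * p + 4)) → T (PAdjᵇ p u v) → T (PAdjᵇ p v u)
  PAdj-sym p u v t rewrite ∨-comm (edge? p (toℕ u) (toℕ v)) (edge? p (toℕ v) (toℕ u)) = t

pK₂∪P₄ : ℕ → Graph
pK₂∪P₄ p = record
  { n = 2 * p + 4
  ; Adj = λ u v → T (PAdjᵇ p u v)
  ; adj? = λ u v → T? (PAdjᵇ p u v)
  ; sym = λ {u} {v} → PAdj-sym p u v
  ; irrefl = λ {u} → PAdj-irrefl p u
  }

HasClique : Graph → ℕ → Set
HasClique G k = Σ (Fin k → Fin (n G)) λ f →
  Injective _≡_ _≡_ f × (∀ i j → ¬ i ≡ j → Adj G (f i) (f j))

IsCliqueNumber : Graph → ℕ → Set
IsCliqueNumber G w = HasClique G w × (∀ k → HasClique G k → k ≤ w)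

Colourable : Graph → ℕ → Set
Colourable G c = Σ (Fin (n G) → Fin c) λ col →
  ∀ u v → Adj G u v → ¬ col u ≡ col v

-- Induction on p and, for fixed p, on the clique number.
-- For p = 0 the graph is P₄-free. Take a Grundy colouring truncated at s = ω levels (the top
-- level s collects everything that would need more). In a P₄-free graph a clique all of whose
-- vertices lie above level j has a common neighbour on level j, so a vertex on level s would
-- lie in a clique with a vertex on each of the levels 0, …, s. Hence all levels lie below s.
-- For p + 1 let a, d₁, …, d_t be a maximum clique; N(a) has smaller clique number. A
-- non-neighbour of a adjacent to d₁, …, d_{i−1} but not to d_i lies in a set that is
-- pK₂ ∪ P₄-free (a copy there plus the edge a d_i is an induced (p+1)K₂ ∪ P₄) and has clique
-- number at most t + 2 − i; the non-neighbours of a adjacent to every d_i are independent.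
-- Pascal's rule adds these bounds up to the claimed one.

module Submission where

open import Defs renaming (sym to Adj-sym)
open import Level using (0ℓ)
open import Data.Nat using (ℕ; zero; suc; _+_; _*_; _≤_; _<_; z≤n; s≤s; s<s; s<s⁻¹; _<ᵇ_; _≤ᵇ_)
open import Data.Nat.Properties hiding (suc-injective)
open import Data.Nat.Combinatorics using (_C_; nC1≡n; nCn≡1; nCk+nC[k+1]≡[n+1]C[k+1])
open import Data.Fin using (Fin; zero; suc; toℕ; fromℕ<)
open import Data.Fin.Properties using (any?; suc-injective; toℕ-injective; toℕ<n; fromℕ<-injective)
  renaming (_≟_ to _≟ᶠ_)
open import Data.Vec.Functional using ([]; _∷_; tail)
open import Data.List using (List; allFin) renaming ([] to []ˡ; _∷_ to _∷ˡ_)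
open import Data.List.Membership.Propositional using () renaming (_∈_ to _∈ˡ_)
open import Data.List.Membership.Propositional.Properties using (∈-allFin)
open import Data.List.Relation.Unary.Any using (here; there)
open import Data.Product using (Σ; ∃; _×_; _,_; proj₁; proj₂)
open import Data.Sum using (_⊎_; inj₁; inj₂; [_,_]′)
open import Data.Bool using (_∨_; T)
open import Data.Bool.Properties using (T-∧; T-∨; ∨-comm; not-involutive)
open import Data.Empty using (⊥-elim)
open import Function using (_∘_)
open import Function.Definitions using (Injective)
open import Function.Bundles using (_⇔_; mk⇔; Equivalence)
open import Relation.Nullary using (¬_; Dec; yes; no; _×-dec_)
open import Relation.Binary.Definitions using (tri<; tri≈; tri>)
open import Relation.Nullary.Decidable using (map′)
open import Relation.Unary using (Pred; Decidable; _∈_; _∉_; _⊆_; _∩_; _∪_; ∁; ∅; U)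
open import Relation.Unary.Properties using (_∩?_; _∪?_; ∁?; ∅?; U?)
open import Relation.Binary.PropositionalEquality
  using (_≡_; _≢_; refl; sym; trans; cong; cong₂; subst; module ≡-Reasoning)

<ᵇ-suc : ∀ m n → (m <ᵇ suc n) ≡ (m ≤ᵇ n)
<ᵇ-suc zero    n = refl
<ᵇ-suc (suc m) n = refl

PatternEdge : ℕ → ℕ → ℕ → Set
PatternEdge p i j = T (edge? p i j ∨ edge? p j i)

edge?⇒suc : ∀ p a b → T (edge? p a b) → suc a ≡ b
edge?⇒suc p a b e = ≡ᵇ⇒≡ (suc a) b (proj₁ (Equivalence.to T-∧ e))

PatternEdge-irrefl : ∀ p i → ¬ PatternEdge p i i
PatternEdge-irrefl p i = [ loop , loop ]′ ∘ Equivalence.to T-∨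
  where loop = 1+n≢n ∘ edge?⇒suc p i i

PatternEdge-sym : ∀ p i j → PatternEdge p i j → PatternEdge p j i
PatternEdge-sym p i j = subst T (∨-comm (edge? p i j) (edge? p j i))

-- Here and below, +-suc q (q + 0) rewrites 2 * suc q, whose normal form is suc (q + suc (q + 0)).
edge?-shift : ∀ q a b → edge? (suc q) (suc (suc a)) (suc (suc b)) ≡ edge? q a b
edge?-shift q a b rewrite +-suc q (q + 0) | <ᵇ-suc (2 * q) a | not-involutive (even a) = refl

PatternEdge-shift : ∀ q i j → PatternEdge (suc q) (suc (suc i)) (suc (suc j)) ≡ PatternEdge q i j
PatternEdge-shift q i j = cong₂ (λ x y → T (x ∨ y)) (edge?-shift q i j) (edge?-shift q j i)

¬PatternEdge-1-2+ : ∀ q j → ¬ PatternEdge (suc q) 1 (suc (suc j))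
¬PatternEdge-1-2+ q zero rewrite +-suc q (q + 0) = λ ()
¬PatternEdge-1-2+ q (suc j) = λ ()

C-pascal : ∀ n k → n C suc k + n C k ≡ suc n C suc k
C-pascal n k = trans (+-comm (n C suc k) (n C k)) (nCk+nC[k+1]≡[n+1]C[k+1] n k)

bound-zero : ∀ w → (w + 2 * 0) C (2 * 0 + 1) ≡ w
bound-zero w = trans (cong (_C 1) (+-identityʳ w)) (nC1≡n w)

bound-suc : ∀ p w → (w + 2 * p) C (2 * p + 1) + (w + 2 * p) C (2 * p) ≡ (suc w + 2 * p) C (2 * p + 1)
bound-suc p w = subst (λ k → m C k + m C (2 * p) ≡ suc m C k) (+-comm 1 (2 * p)) (C-pascal m (2 * p))
  where m = w + 2 * p

bound-mono : ∀ p w → (w + 2 * p) C (2 * p + 1) ≤ (suc w + 2 * p) C (2 * p + 1)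
bound-mono p w = subst ((w + 2 * p) C (2 * p + 1) ≤_) (bound-suc p w) (m≤m+n _ _)

bound-step : ∀ q t → (t + 2 * suc q) C (2 * suc q) + (suc (suc t) + 2 * q) C (2 * q + 1)
                   ≡ (suc t + 2 * suc q) C (2 * suc q)
bound-step q t = begin
    m C (2 * suc q) + (suc (suc t) + 2 * q) C k
      ≡⟨ cong (λ x → m C (2 * suc q) + x C k) (sym m≡2+t+2q) ⟩
    m C (2 * suc q) + m C k
      ≡⟨ subst (λ l → m C l + m C k ≡ suc m C l) 1+k≡2+2q (C-pascal m k) ⟩
    suc m C (2 * suc q) ∎
  where
  open ≡-Reasoning
  m = t + 2 * suc q
  k = 2 * q + 1
  m≡2+t+2q : m ≡ suc (suc t) + 2 * q
  m≡2+t+2q = trans (cong (t +_) (*-suc 2 q)) (trans (+-suc t _) (cong suc (+-suc t _)))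
  1+k≡2+2q : suc k ≡ 2 * suc q
  1+k≡2+2q = trans (cong suc (+-comm (2 * q) 1)) (sym (*-suc 2 q))

module _ (G : Graph) where

  V : Set
  V = Fin (n G)

  infix 4 _~_
  _~_ : V → V → Set
  _~_ = Adj G

  N : V → Pred V 0ℓ
  N = Adj G

  N? : ∀ v → Decidable (N v)
  N? = adj? G

  ~⇒≢ : ∀ {u v} → u ~ v → u ≢ v
  ~⇒≢ u~v refl = irrefl G u~v

  record IsClique {k} (S : Pred V 0ℓ) (K : Fin k → V) : Set where
    constructor _,_
    field
      members  : ∀ i → K i ∈ S
      adjacent : ∀ i j → i ≢ j → K i ~ K j

  Clique : Pred V 0ℓ → ℕ → Set
  Clique S k = Σ (Fin k → V) (IsClique S)

  isClique-mono : ∀ {S S′ k} {K : Fin k → V} → S ⊆ S′ → IsClique S K → IsClique S′ K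
  isClique-mono S⊆S′ (K∈S , K~K) = S⊆S′ ∘ K∈S , K~K

  clique-mono : ∀ {S S′ k} → S ⊆ S′ → Clique S k → Clique S′ k
  clique-mono S⊆S′ (K , K-clique) = K , isClique-mono S⊆S′ K-clique

  clique-[] : ∀ {S} → IsClique S []
  clique-[] = (λ ()) , (λ ())

  clique-∷ : ∀ {S k v} {K : Fin k → V} → v ∈ S → IsClique (S ∩ N v) K → IsClique S (v ∷ K)
  clique-∷ {S} {v = v} {K} v∈S (K∈ , K~K) = members , adjacent
    where
    members : ∀ i → (v ∷ K) i ∈ S
    members zero    = v∈S
    members (suc i) = proj₁ (K∈ i)
    adjacent : ∀ i j → i ≢ j → (v ∷ K) i ~ (v ∷ K) j
    adjacent zero    zero    i≢j = ⊥-elim (i≢j refl)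
    adjacent zero    (suc j) _   = proj₂ (K∈ j)
    adjacent (suc i) zero    _   = Adj-sym G (proj₂ (K∈ i))
    adjacent (suc i) (suc j) i≢j = K~K i j (i≢j ∘ cong suc)

  clique-uncons : ∀ {S k} {K : Fin (suc k) → V} → IsClique S K →
                  K zero ∈ S × IsClique (S ∩ N (K zero)) (tail K)
  clique-uncons (K∈ , K~K) =
    K∈ zero ,
    (λ i → K∈ (suc i) , K~K zero (suc i) (λ ())) ,
    (λ i j i≢j → K~K (suc i) (suc j) (i≢j ∘ suc-injective))

  clique-pair : ∀ {S u v} → u ∈ S → v ∈ S → u ~ v → Clique S 2
  clique-pair u∈S v∈S u~v = _ , clique-∷ u∈S (clique-∷ (v∈S , u~v) clique-[])

  noClique-∩N : ∀ {S v m} → v ∈ S → ¬ Clique S (suc m) → ¬ Clique (S ∩ N v) m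
  noClique-∩N v∈S noClique (K , K-clique) = noClique (_ , clique-∷ v∈S K-clique)

  clique? : ∀ {S} → Decidable S → ∀ k → Dec (Clique S k)
  clique? S? zero    = yes ([] , clique-[])
  clique? {S} S? (suc k) = map′ cons uncons (any? λ v → S? v ×-dec clique? (S? ∩? N? v) k)
    where
    cons : ∃ (λ v → v ∈ S × Clique (S ∩ N v) k) → Clique S (suc k)
    cons (v , v∈S , K , K-clique) = v ∷ K , clique-∷ v∈S K-clique
    uncons : Clique S (suc k) → ∃ (λ v → v ∈ S × Clique (S ∩ N v) k)
    uncons (K , K-clique) = let (K₀∈S , tail-clique) = clique-uncons K-clique
                            in K zero , K₀∈S , tail K , tail-clique

  record Colouring (S : Pred V 0ℓ) (k : ℕ) : Set where
    field
      colour  : V → ℕ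
      colour< : ∀ {v} → v ∈ S → colour v < k
      proper  : ∀ {u v} → u ∈ S → v ∈ S → u ~ v → colour u ≢ colour v

  colouring-⊆ : ∀ {S S′ k} → S ⊆ S′ → Colouring S′ k → Colouring S k
  colouring-⊆ S⊆S′ c = record
    { colour  = colour
    ; colour< = colour< ∘ S⊆S′
    ; proper  = λ u∈S v∈S → proper (S⊆S′ u∈S) (S⊆S′ v∈S)
    }
    where open Colouring c

  colouring-≤ : ∀ {S k k′} → k ≤ k′ → Colouring S k → Colouring S k′
  colouring-≤ k≤k′ c = record
    { colour = colour ; colour< = λ v∈S → <-≤-trans (colour< v∈S) k≤k′ ; proper = proper }
    where open Colouring c

  colouring-empty : ∀ {S k} → ¬ Clique S 1 → Colouring S k
  colouring-empty noVertex = record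
    { colour  = λ _ → 0
    ; colour< = λ v∈S → ⊥-elim (noVertex (_ , clique-∷ v∈S clique-[]))
    ; proper  = λ u∈S _ _ → ⊥-elim (noVertex (_ , clique-∷ u∈S clique-[]))
    }

  colouring-independent : ∀ {S} → ¬ Clique S 2 → Colouring S 1
  colouring-independent noEdge = record
    { colour  = λ _ → 0
    ; colour< = λ _ → s≤s z≤n
    ; proper  = λ u∈S v∈S u~v _ → noEdge (clique-pair u∈S v∈S u~v)
    }

  colouring-split : ∀ {S P k₁ k₂} → Decidable P →
                    Colouring (S ∩ P) k₁ → Colouring (S ∩ ∁ P) k₂ → Colouring S (k₁ + k₂)
  colouring-split {S} {P} {k₁} {k₂} P? c₁ c₂ =
    record { colour = colour ; colour< = colour< ; proper = proper }
    where
    module C₁ = Colouring c₁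
    module C₂ = Colouring c₂
    colour : V → ℕ
    colour v with P? v
    ... | yes _ = C₁.colour v
    ... | no  _ = k₁ + C₂.colour v
    colour< : ∀ {v} → v ∈ S → colour v < k₁ + k₂
    colour< {v} v∈S with P? v
    ... | yes v∈P = <-≤-trans (C₁.colour< (v∈S , v∈P)) (m≤m+n k₁ k₂)
    ... | no  v∉P = +-monoʳ-< k₁ (C₂.colour< (v∈S , v∉P))
    proper : ∀ {u v} → u ∈ S → v ∈ S → u ~ v → colour u ≢ colour v
    proper {u} {v} u∈S v∈S u~v with P? u | P? v
    ... | yes u∈P | yes v∈P = C₁.proper (u∈S , u∈P) (v∈S , v∈P) u~v
    ... | no  u∉P | no  v∉P = C₂.proper (u∈S , u∉P) (v∈S , v∉P) u~v ∘ +-cancelˡ-≡ k₁ _ _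
    ... | yes u∈P | no  _   = λ eq → m+n≮m k₁ _ (subst (_< k₁) eq (C₁.colour< (u∈S , u∈P)))
    ... | no  _   | yes v∈P = λ eq → m+n≮m k₁ _ (subst (_< k₁) (sym eq) (C₁.colour< (v∈S , v∈P)))

  Independent : Pred V 0ℓ → Set
  Independent I = ∀ {u v} → u ∈ I → v ∈ I → ¬ u ~ v

  Dominated : Pred V 0ℓ → V → Set
  Dominated I v = v ∈ I ⊎ ∃ λ u → u ∈ I × v ~ u

  dominated-mono : ∀ {I I′ v} → I ⊆ I′ → Dominated I v → Dominated I′ v
  dominated-mono I⊆I′ (inj₁ v∈I)           = inj₁ (I⊆I′ v∈I)
  dominated-mono I⊆I′ (inj₂ (u , u∈I , v~u)) = inj₂ (u , I⊆I′ u∈I , v~u)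

  record IndependentDominating (R W : Pred V 0ℓ) : Set₁ where
    field
      I           : Pred V 0ℓ
      I?          : Decidable I
      I⊆R         : I ⊆ R
      independent : Independent I
      dominating  : ∀ {v} → v ∈ W → v ∈ R → Dominated I v

  redominate : ∀ {R W W′} (J : IndependentDominating R W) →
               (∀ {v} → v ∈ W′ → v ∈ R → Dominated (IndependentDominating.I J) v) →
               IndependentDominating R W′
  redominate J dominating′ = record
    { I = I ; I? = I? ; I⊆R = I⊆R ; independent = independent ; dominating = dominating′ }
    where open IndependentDominating J

  module _ {R : Pred V 0ℓ} (R? : Decidable R) where

    greedyIndependent : (L : List V) → IndependentDominating R (_∈ˡ L)
    greedyIndependent []ˡ = record
      { I = ∅ ; I? = ∅? ; I⊆R = λ () ; independent = λ () ; dominating = λ () }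
    greedyIndependent (v ∷ˡ L) with greedyIndependent L
    ... | J with R? v | any? (λ u → IndependentDominating.I? J u ×-dec N? v u)
    ...   | no v∉R | _ = redominate J
      λ { (here refl) v∈R → ⊥-elim (v∉R v∈R) ; (there u∈L) → IndependentDominating.dominating J u∈L }
    ...   | yes _ | yes (u , u∈I , v~u) = redominate J
      λ { (here refl) _ → inj₂ (u , u∈I , v~u) ; (there u∈L) → IndependentDominating.dominating J u∈L }
    ...   | yes v∈R | no noNeighbour = record
      { I           = I ∪ (_≡ v)
      ; I?          = I? ∪? (_≟ᶠ v)
      ; I⊆R         = λ { (inj₁ u∈I) → I⊆R u∈I ; (inj₂ refl) → v∈R }
      ; independent = independent′
      ; dominating  = λ { (here refl) _ → inj₁ (inj₂ refl)
                        ; (there u∈L) u∈R → dominated-mono inj₁ (dominating u∈L u∈R) }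
      }
      where
      open IndependentDominating J
      independent′ : Independent (I ∪ (_≡ v))
      independent′ (inj₁ u∈I)  (inj₁ w∈I)  = independent u∈I w∈I
      independent′ (inj₁ u∈I)  (inj₂ refl) = λ u~v → noNeighbour (_ , u∈I , Adj-sym G u~v)
      independent′ (inj₂ refl) (inj₁ w∈I)  = λ v~w → noNeighbour (_ , w∈I , v~w)
      independent′ (inj₂ refl) (inj₂ refl) = irrefl G

    maximalIndependent : IndependentDominating R U
    maximalIndependent = redominate J (λ {v} _ → IndependentDominating.dominating J (∈-allFin v))
      where J = greedyIndependent (allFin (n G))

  -- Below the top level j this is a Grundy colouring of S.
  record GrundyLabelling (S : Pred V 0ℓ) (j : ℕ) : Set where
    field
      level    : V → ℕ
      level≤   : ∀ {v} → v ∈ S → level v ≤ j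
      top-only : ∀ {u v} → u ∈ S → v ∈ S → u ~ v → level u ≡ level v → level u ≡ j
      greedy   : ∀ {v} → v ∈ S → ∀ {i} → i < level v → ∃ λ u → u ∈ S × level u ≡ i × v ~ u

  module _ {S : Pred V 0ℓ} (S? : Decidable S) where

    -- Keep a maximal independent set of the top level and lift the rest of it by one.
    grundy-step : ∀ {j} → GrundyLabelling S j → GrundyLabelling S (suc j)
    grundy-step {j} L = record
      { level = level′ ; level≤ = level′≤ ; top-only = top-only′ ; greedy = greedy′ }
      where
      open GrundyLabelling L
      open IndependentDominating (maximalIndependent (S? ∩? λ v → level v ≟ j))

      lift : ∀ v → Dec (level v ≡ j) → Dec (v ∈ I) → ℕ
      lift v (yes _) (no _) = suc j
      lift v _       _      = level v

      level′ : V → ℕ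
      level′ v = lift v (level v ≟ j) (I? v)

      data Fate (v : V) (l : ℕ) : Set where
        lifted    : level v ≡ j → v ∉ I → l ≡ suc j → Fate v l
        unchanged : (level v ≡ j → v ∈ I) → l ≡ level v → Fate v l

      fate-lift : ∀ v d i → Fate v (lift v d i)
      fate-lift v (yes lv≡j) (no v∉I)  = lifted lv≡j v∉I refl
      fate-lift v (yes _)    (yes v∈I) = unchanged (λ _ → v∈I) refl
      fate-lift v (no lv≢j)  _         = unchanged (⊥-elim ∘ lv≢j) refl

      fate : ∀ v → Fate v (level′ v)
      fate v = fate-lift v (level v ≟ j) (I? v)

      level′≤ : ∀ {v} → v ∈ S → level′ v ≤ suc j
      level′≤ {v} v∈S with fate v
      ... | lifted _ _ e  = ≤-reflexive e
      ... | unchanged _ e = subst (_≤ suc j) (sym e) (m≤n⇒m≤1+n (level≤ v∈S))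

      top-only′ : ∀ {u v} → u ∈ S → v ∈ S → u ~ v → level′ u ≡ level′ v → level′ u ≡ suc j
      top-only′ {u} {v} u∈S v∈S u~v eq with fate u | fate v
      ... | lifted _ _ eu | _ = eu
      ... | unchanged _ eu | lifted _ _ ev =
        ⊥-elim (1+n≰n (subst (_≤ j) (trans (sym eu) (trans eq ev)) (level≤ u∈S)))
      ... | unchanged u-kept eu | unchanged v-kept ev =
        ⊥-elim (independent (u-kept lu≡j) (v-kept (trans (sym lu≡lv) lu≡j)) u~v)
        where
        lu≡lv = trans (sym eu) (trans eq ev)
        lu≡j  = top-only u∈S v∈S u~v lu≡lv

      level′-below : ∀ {u} → level u < j → level′ u ≡ level u
      level′-below {u} lu<j with fate u
      ... | lifted lu≡j _ _ = ⊥-elim (<⇒≢ lu<j lu≡j)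
      ... | unchanged _ e   = e

      level′-kept : ∀ {u} → u ∈ I → level′ u ≡ j
      level′-kept {u} u∈I with fate u
      ... | lifted _ u∉I _ = ⊥-elim (u∉I u∈I)
      ... | unchanged _ e  = trans e (proj₂ (I⊆R u∈I))

      greedy-below : ∀ {v} → v ∈ S → ∀ {i} → i < level v → i < j →
                     ∃ λ u → u ∈ S × level′ u ≡ i × v ~ u
      greedy-below v∈S i<lv i<j with greedy v∈S i<lv
      ... | u , u∈S , refl , v~u = u , u∈S , level′-below i<j , v~u

      greedy′ : ∀ {v} → v ∈ S → ∀ {i} → i < level′ v → ∃ λ u → u ∈ S × level′ u ≡ i × v ~ u
      greedy′ {v} v∈S {i} i<l′v with fate v
      ... | unchanged _ e = greedy-below v∈S i<lv (<-≤-trans i<lv (level≤ v∈S))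
        where i<lv = subst (i <_) e i<l′v
      ... | lifted lv≡j v∉I e with m<1+n⇒m<n∨m≡n (subst (i <_) e i<l′v)
      ...   | inj₁ i<j  = greedy-below v∈S (subst (i <_) (sym lv≡j) i<j) i<j
      ...   | inj₂ refl with dominating _ (v∈S , lv≡j)
      ...     | inj₁ v∈I             = ⊥-elim (v∉I v∈I)
      ...     | inj₂ (u , u∈I , v~u) = u , proj₁ (I⊆R u∈I) , level′-kept u∈I , v~u

    grundyLabelling : ∀ j → GrundyLabelling S j
    grundyLabelling zero = record
      { level = λ _ → 0 ; level≤ = λ _ → z≤n ; top-only = λ _ _ _ _ → refl ; greedy = λ _ () }
    grundyLabelling (suc j) = grundy-step (grundyLabelling j)

  -- The vertices of pK₂ ∪ P₄ are indexed by ℕ rather than Fin (2p + 4), so that prepending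
  -- an edge is a shift by two.
  record InducedCopy (p : ℕ) (S : Pred V 0ℓ) : Set where
    field
      vertex    : ℕ → V
      vertex∈   : ∀ i → i < 2 * p + 4 → vertex i ∈ S
      injective : ∀ i j → i < 2 * p + 4 → j < 2 * p + 4 → vertex i ≡ vertex j → i ≡ j
      edges     : ∀ i j → i < 2 * p + 4 → j < 2 * p + 4 → PatternEdge p i j ⇔ vertex i ~ vertex j

  FreeIn : ℕ → Pred V 0ℓ → Set
  FreeIn p S = ¬ InducedCopy p S

  copy-mono : ∀ {p S S′} → S ⊆ S′ → InducedCopy p S → InducedCopy p S′
  copy-mono S⊆S′ C = record
    { vertex = vertex ; vertex∈ = λ i i<m → S⊆S′ (vertex∈ i i<m) ; injective = injective ; edges = edges }
    where open InducedCopy C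

  inducedCopy : ∀ {p S} (f : ℕ → V) → (∀ i → i < 2 * p + 4 → f i ∈ S) →
                (∀ i j → i < j → j < 2 * p + 4 → f i ≢ f j) →
                (∀ i j → i < j → j < 2 * p + 4 → PatternEdge p i j ⇔ f i ~ f j) →
                InducedCopy p S
  inducedCopy {p} f f∈S distinct edges< = record
    { vertex = f ; vertex∈ = f∈S ; injective = injective ; edges = edges }
    where
    injective : ∀ i j → i < 2 * p + 4 → j < 2 * p + 4 → f i ≡ f j → i ≡ j
    injective i j i<m j<m fi≡fj with <-cmp i j
    ... | tri< i<j _ _   = ⊥-elim (distinct i j i<j j<m fi≡fj)
    ... | tri≈ _ i≡j _   = i≡j
    ... | tri> _ _ j<i   = ⊥-elim (distinct j i j<i i<m (sym fi≡fj))
    edges : ∀ i j → i < 2 * p + 4 → j < 2 * p + 4 → PatternEdge p i j ⇔ f i ~ f j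
    edges i j i<m j<m with <-cmp i j
    ... | tri< i<j _ _  = edges< i j i<j j<m
    ... | tri≈ _ refl _ = mk⇔ (⊥-elim ∘ PatternEdge-irrefl p i) (⊥-elim ∘ irrefl G)
    ... | tri> _ _ j<i  =
      mk⇔ (Adj-sym G ∘ to ∘ PatternEdge-sym p i j) (PatternEdge-sym p j i ∘ from ∘ Adj-sym G)
      where open Equivalence (edges< j i j<i i<m)

  inducedP₄ : ∀ {S a b c d} → a ∈ S → b ∈ S → c ∈ S → d ∈ S →
              a ~ b → b ~ c → c ~ d → ¬ a ~ c → ¬ a ~ d → ¬ b ~ d → InducedCopy 0 S
  inducedP₄ {S} {a} {b} {c} {d} a∈S b∈S c∈S d∈S a~b b~c c~d a≁c a≁d b≁d =
    inducedCopy path members distinct edges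
    where
    path : ℕ → V
    path 0 = a
    path 1 = b
    path 2 = c
    path _ = d
    members : ∀ i → i < 4 → path i ∈ S
    members 0 _ = a∈S
    members 1 _ = b∈S
    members 2 _ = c∈S
    members 3 _ = d∈S
    members (suc (suc (suc (suc _)))) (s≤s (s≤s (s≤s (s≤s ()))))
    distinct : ∀ i j → i < j → j < 4 → path i ≢ path j
    distinct 0 1 _ _ = ~⇒≢ a~b
    distinct 0 2 _ _ = λ { refl → a≁d c~d }
    distinct 0 3 _ _ = λ { refl → b≁d (Adj-sym G a~b) }
    distinct 1 2 _ _ = ~⇒≢ b~c
    distinct 1 3 _ _ = λ { refl → a≁d a~b }
    distinct 2 3 _ _ = ~⇒≢ c~d
    distinct (suc _)             1 (s≤s ()) _
    distinct (suc (suc _))       2 (s≤s (s≤s ())) _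
    distinct (suc (suc (suc _))) 3 (s≤s (s≤s (s≤s ()))) _
    distinct _ (suc (suc (suc (suc _)))) _ (s≤s (s≤s (s≤s (s≤s ()))))
    edges : ∀ i j → i < j → j < 4 → PatternEdge 0 i j ⇔ path i ~ path j
    edges 0 1 _ _ = mk⇔ (λ _ → a~b) _
    edges 0 2 _ _ = mk⇔ (λ ()) a≁c
    edges 0 3 _ _ = mk⇔ (λ ()) a≁d
    edges 1 2 _ _ = mk⇔ (λ _ → b~c) _
    edges 1 3 _ _ = mk⇔ (λ ()) b≁d
    edges 2 3 _ _ = mk⇔ (λ _ → c~d) _
    edges (suc _)             1 (s≤s ()) _
    edges (suc (suc _))       2 (s≤s (s≤s ())) _
    edges (suc (suc (suc _))) 3 (s≤s (s≤s (s≤s ()))) _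
    edges _ (suc (suc (suc (suc _)))) _ (s≤s (s≤s (s≤s (s≤s ()))))

  extendCopy : ∀ {q S S′ a d} → a ∈ S → d ∈ S → a ~ d → S′ ⊆ S ∩ ∁ (N a) ∩ ∁ (N d) →
               InducedCopy q S′ → InducedCopy (suc q) S
  extendCopy {q} {S} {S′} {a} {d} a∈S d∈S a~d S′⊆ C = inducedCopy vertex′ members distinct edges′
    where
    open InducedCopy C
    vertex′ : ℕ → V
    vertex′ 0             = a
    vertex′ 1             = d
    vertex′ (suc (suc i)) = vertex i
    unshift : ∀ {i} → suc (suc i) < 2 * suc q + 4 → i < 2 * q + 4
    unshift {i} i<m = s<s⁻¹ (s<s⁻¹ (subst (suc (suc i) <_) (cong (_+ 4) (*-suc 2 q)) i<m))
    outside : ∀ {i} → suc (suc i) < 2 * suc q + 4 → vertex i ∈ S ∩ ∁ (N a) ∩ ∁ (N d)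
    outside {i} i<m = S′⊆ (vertex∈ i (unshift i<m))
    members : ∀ i → i < 2 * suc q + 4 → vertex′ i ∈ S
    members 0             _   = a∈S
    members 1             _   = d∈S
    members (suc (suc i)) i<m = proj₁ (outside i<m)
    distinct : ∀ i j → i < j → j < 2 * suc q + 4 → vertex′ i ≢ vertex′ j
    distinct 0 1 _ _ = ~⇒≢ a~d
    distinct 0 (suc (suc j)) _ j<m refl = proj₂ (proj₂ (outside j<m)) (Adj-sym G a~d)
    distinct 1 (suc (suc j)) _ j<m refl = proj₁ (proj₂ (outside j<m)) a~d
    distinct (suc (suc i)) (suc (suc j)) (s≤s (s≤s i<j)) j<m =
      <⇒≢ i<j ∘ injective i j (unshift (<-trans (s<s (s<s i<j)) j<m)) (unshift j<m)
    distinct (suc _) 1 (s≤s ()) _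
    edges′ : ∀ i j → i < j → j < 2 * suc q + 4 → PatternEdge (suc q) i j ⇔ vertex′ i ~ vertex′ j
    edges′ 0 1 _ _ = mk⇔ (λ _ → a~d) _
    edges′ 0 (suc (suc j)) _ j<m = mk⇔ (λ ()) (proj₁ (proj₂ (outside j<m)))
    edges′ 1 (suc (suc j)) _ j<m =
      mk⇔ (⊥-elim ∘ ¬PatternEdge-1-2+ q j) (⊥-elim ∘ proj₂ (proj₂ (outside j<m)))
    edges′ (suc (suc i)) (suc (suc j)) (s≤s (s≤s i<j)) j<m =
      subst (_⇔ vertex i ~ vertex j) (sym (PatternEdge-shift q i j))
            (edges i j (unshift (<-trans (s<s (s<s i<j)) j<m)) (unshift j<m))
    edges′ (suc _) 1 (s≤s ()) _

  module Cograph {S : Pred V 0ℓ} (free : FreeIn 0 S) {s : ℕ} (L : GrundyLabelling S s) where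
    open GrundyLabelling L

    commonNeighbour : ∀ {j} → j < s → ∀ {t} {K : Fin (suc t) → V} → IsClique S K →
                      (∀ i → j < level (K i)) → ∃ λ y → y ∈ S × level y ≡ j × (∀ i → y ~ K i)
    commonNeighbour j<s {zero} K-clique above with greedy (IsClique.members K-clique zero) (above zero)
    ... | y , y∈S , ly≡j , K₀~y = y , y∈S , ly≡j , λ { zero → Adj-sym G K₀~y }
    commonNeighbour j<s {suc t} {K} K-clique above
      with commonNeighbour j<s (isClique-mono proj₁ (proj₂ (clique-uncons K-clique))) (above ∘ suc)
    ... | y , y∈S , ly≡j , y~tail with N? (K zero) y
    ...   | yes K₀~y = y , y∈S , ly≡j , λ { zero → Adj-sym G K₀~y ; (suc i) → y~tail i }
    ...   | no K₀≁y with greedy (IsClique.members K-clique zero) (above zero)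
    ...     | y′ , y′∈S , ly′≡j , K₀~y′ = y′ , y′∈S , ly′≡j , y′~K
      where
      open IsClique K-clique
      y≁y′ : ¬ y ~ y′
      y≁y′ y~y′ = <⇒≢ j<s (trans (sym ly≡j) (top-only y∈S y′∈S y~y′ (trans ly≡j (sym ly′≡j))))
      -- Otherwise y − K i − K 0 − y′ is an induced P₄.
      y′~K : ∀ i → y′ ~ K i
      y′~K zero    = Adj-sym G K₀~y′
      y′~K (suc i) with N? y′ (K (suc i))
      ... | yes y′~Kᵢ = y′~Kᵢ
      ... | no  y′≁Kᵢ = ⊥-elim (free (inducedP₄ y∈S (members (suc i)) (members zero) y′∈S
                          (y~tail i) (adjacent (suc i) zero (λ ())) K₀~y′
                          (K₀≁y ∘ Adj-sym G) y≁y′ (y′≁Kᵢ ∘ Adj-sym G)))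

    cliqueAcrossLevels : ∀ {v} → v ∈ S → level v ≡ s → ∀ m j → m + j ≡ s →
                         ∃ λ (K : Fin (suc m) → V) → IsClique S K × (∀ i → j ≤ level (K i))
    cliqueAcrossLevels {v} v∈S lv≡s zero j j≡s =
      v ∷ [] , clique-∷ v∈S clique-[] , λ { zero → ≤-reflexive (trans j≡s (sym lv≡s)) }
    cliqueAcrossLevels v∈S lv≡s (suc m) j m+j≡s
      with cliqueAcrossLevels v∈S lv≡s m (suc j) (trans (+-suc m j) m+j≡s)
    ... | K , (K∈S , K~K) , above
      with commonNeighbour (subst (j <_) m+j≡s (s≤s (m≤n+m j m))) (K∈S , K~K) above
    ...   | y , y∈S , ly≡j , y~K =
      y ∷ K ,
      clique-∷ y∈S ((λ i → K∈S i , y~K i) , K~K) ,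
      λ { zero → ≤-reflexive (sym ly≡j) ; (suc i) → <⇒≤ (above i) }

    clique-at-top : ∀ {v} → v ∈ S → level v ≡ s → Clique S (suc s)
    clique-at-top v∈S lv≡s with cliqueAcrossLevels v∈S lv≡s s 0 (+-identityʳ s)
    ... | K , K-clique , _ = K , K-clique

  P₄-free-colouring : ∀ {S} → Decidable S → FreeIn 0 S →
                      ∀ {s} → ¬ Clique S (suc s) → Colouring S s
  P₄-free-colouring {S} S? free {s} noClique = record
    { colour  = level
    ; colour< = level<
    ; proper  = λ u∈S v∈S u~v eq → <⇒≢ (level< u∈S) (top-only u∈S v∈S u~v eq)
    }
    where
    L = grundyLabelling S? s
    open GrundyLabelling L
    level< : ∀ {v} → v ∈ S → level v < s
    level< v∈S = ≤∧≢⇒< (level≤ v∈S) (noClique ∘ Cograph.clique-at-top free L v∈S)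

  ChromaticBound : ℕ → Set₁
  ChromaticBound p = ∀ {S} → Decidable S → FreeIn p S →
                     ∀ w → ¬ Clique S (suc w) → Colouring S ((w + 2 * p) C (2 * p + 1))

  module InductionStep {q : ℕ} (chromaticBound-q : ChromaticBound q) where

    nonNeighbours : ∀ t {X} → Decidable X → FreeIn (suc q) X → ¬ Clique X (suc (suc t)) →
                    ∀ {a} {D : Fin t → V} → a ∈ X → IsClique (X ∩ N a) D →
                    Colouring (X ∩ ∁ (N a)) ((t + 2 * suc q) C (2 * suc q))
    nonNeighbours zero X? free noEdge a∈X _ =
      colouring-≤ (≤-reflexive (sym (nCn≡1 (2 * suc q))))
                  (colouring-independent (noEdge ∘ clique-mono proj₁))
    nonNeighbours (suc t) {X} X? free noClique {a} {D} a∈X D-clique =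
      colouring-≤ (≤-reflexive (bound-step q t)) (colouring-split (N? d) adjacent-to-d nonadjacent-to-d)
      where
      d = D zero
      d∈X = proj₁ (proj₁ (clique-uncons D-clique))
      a~d = proj₂ (proj₁ (clique-uncons D-clique))
      adjacent-to-d : Colouring ((X ∩ ∁ (N a)) ∩ N d) ((t + 2 * suc q) C (2 * suc q))
      adjacent-to-d =
        colouring-⊆ (λ ((x∈X , a≁x) , d~x) → (x∈X , d~x) , a≁x)
          (nonNeighbours t (X? ∩? N? d) (free ∘ copy-mono proj₁) (noClique-∩N d∈X noClique)
             (a∈X , Adj-sym G a~d)
             (isClique-mono (λ ((x∈X , a~x) , d~x) → (x∈X , d~x) , a~x)
                            (proj₂ (clique-uncons D-clique))))
      nonadjacent-to-d : Colouring ((X ∩ ∁ (N a)) ∩ ∁ (N d)) ((suc (suc t) + 2 * q) C (2 * q + 1))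
      nonadjacent-to-d =
        chromaticBound-q ((X? ∩? ∁? (N? a)) ∩? ∁? (N? d))
          (free ∘ extendCopy a∈X d∈X a~d (λ ((x∈X , a≁x) , d≁x) → x∈X , a≁x , d≁x))
          (suc (suc t)) (noClique ∘ clique-mono (proj₁ ∘ proj₁))

    chromaticBound-suc : ChromaticBound (suc q)
    chromaticBound-suc S? free zero noVertex = colouring-empty noVertex
    chromaticBound-suc S? free (suc w) noClique with clique? S? (suc w)
    ... | no noSmallerClique =
      colouring-≤ (bound-mono (suc q) w) (chromaticBound-suc S? free w noSmallerClique)
    ... | yes (K , K-clique) =
      colouring-≤ (≤-reflexive (bound-suc (suc q) w))
        (colouring-split (N? a)
          (chromaticBound-suc (S? ∩? N? a) (free ∘ copy-mono proj₁) w (noClique-∩N a∈S noClique))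
          (nonNeighbours w S? free noClique a∈S (proj₂ (clique-uncons K-clique))))
      where
      a = K zero
      a∈S = proj₁ (clique-uncons K-clique)

  chromaticBound : ∀ p → ChromaticBound p
  chromaticBound zero S? free w noClique =
    colouring-≤ (≤-reflexive (sym (bound-zero w))) (P₄-free-colouring S? free noClique)
  chromaticBound (suc q) = InductionStep.chromaticBound-suc (chromaticBound q)

  clique-injective : ∀ {S k} {K : Fin k → V} → IsClique S K → Injective _≡_ _≡_ K
  clique-injective {K = K} (_ , adjacent) {i} {j} Ki≡Kj with i ≟ᶠ j
  ... | yes i≡j = i≡j
  ... | no  i≢j = ⊥-elim (~⇒≢ (adjacent i j i≢j) Ki≡Kj)

  induced : ∀ {p} → InducedCopy p U → InducedSub (pK₂∪P₄ p) G
  induced C =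
    vertex ∘ toℕ ,
    (λ {u} {v} → toℕ-injective ∘ injective (toℕ u) (toℕ v) (toℕ<n u) (toℕ<n v)) ,
    (λ u v → edges (toℕ u) (toℕ v) (toℕ<n u) (toℕ<n v))
    where open InducedCopy C

  noClique-above : ∀ {w} → IsCliqueNumber G w → ¬ Clique U (suc w)
  noClique-above (_ , maximum) (K , K-clique) =
    1+n≰n (maximum _ (K , clique-injective K-clique , IsClique.adjacent K-clique))

  colourable : ∀ {k} → Colouring U k → Colourable G k
  colourable c =
    (λ v → fromℕ< (colour< {v} _)) ,
    (λ u v u~v → proper _ _ u~v ∘ fromℕ<-injective (colour u) (colour v) (colour< _) (colour< _))
    where open Colouring c

-- The bound holds for p = 0 as well (P₄-free graphs are perfect).
mainTheorem20 : (p : ℕ) → 1 ≤ p → (G : Graph) → Free (pK₂∪P₄ p) G →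
    (w : ℕ) → IsCliqueNumber G w → Colourable G ((w + 2 * p) C (2 * p + 1))
mainTheorem20 p _ G free w ω≡w =
  colourable G (chromaticBound G p U? (free ∘ induced G) w (noClique-above G ω≡w))
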